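{- If $n\geq 3$, $m\geq 1$ and $p\geq 2$ are integers, then $$\chi_\rho(FSSD_m(C_n\star P_p)) \leq \begin{cases} 6, & n=3,\\ 7, & n\geq 4,\ n\notin\{5,7,11\},\\ 8, & n\in\{5,7,11\}.\end{cases}$$
   Context: All graphs are finite and simple. For a positive integer $i$, an $i$-packing is a set of vertices in which any two distinct vertices are at distance greater than $i$. The packing chromatic number $\chi_\rho(H)$ of a graph $H$ is the smallest integer $k$ such that $V(H)$ can be partitioned into sets $V_1,\dots,V_k$ with each $V_i$ an $i$-packing. The neighborhood corona $G\star H$ of a graph $G$ with vertices $w_1,\dots,w_{n_1}$ and a graph $H$ is obtained from one copy of $G$ and $n_1$ disjoint copies $H_1,\dots,H_{n_1}$ of $H$ by joining every vertex of $H_i$ to every neighbor of $w_i$ in $G$. Here $C_n$ is the cycle on $n$ vertices and $P_p$ is the path on $p$ vertices. For a positive integer $m$, the finite super subdivision graph $FSSD_m(G)$ is obtained from a graph $G$ by replacing each edge $xy$ of $G$ by a complete bipartite graph $K_{2,m}$ whose part of size $2$ is $\{x,y\}$; that is, the edge $xy$ is deleted and $m$ new vertices are added, each adjacent exactly to $x$ and $y$. -}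

module Defs where

open import Data.Nat using (ℕ; zero; suc; _≤_)
open import Data.Nat.DivMod using (_mod_)
open import Data.Fin using (Fin; toℕ; inject₁) renaming (suc to fsuc)
open import Data.Product using (Σ; ∃; _×_; _,_)
open import Data.Sum using (_⊎_; inj₁; inj₂)
open import Data.Bool using (Bool; true; false)
open import Relation.Binary.PropositionalEquality using (_≡_; _≢_)
open import Relation.Nullary using (¬_)

-- A finite simple graph presented by a vertex type and an edge type,
-- each edge listed exactly once by its (ordered) pair of endpoints.
record Graph : Set₁ where
  field
    V    : Set
    E    : Set
    ends : E → V × V
open Graph public

Adj : (G : Graph) → V G → V G → Set
Adj G x y = ∃ λ e → (ends G e ≡ (x , y)) ⊎ (ends G e ≡ (y , x))

-- Within i : there is a walk of length at most i from x to y,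
-- i.e. dist(x , y) ≤ i.
Within : (G : Graph) → ℕ → V G → V G → Set
Within G zero    x y = x ≡ y
Within G (suc i) x y = (x ≡ y) ⊎ (∃ λ z → Adj G x z × Within G i z y)

-- A packing k-colouring: colour c x : Fin k stands for colour 1 + toℕ (c x);
-- the class of colour j must be a j-packing (distinct vertices at distance > j).
IsPackingColouring : (G : Graph) (k : ℕ) → (V G → Fin k) → Set
IsPackingColouring G k c =
  ∀ x y → x ≢ y → c x ≡ c y → ¬ Within G (suc (toℕ (c x))) x y

-- χ_ρ(G) ≤ k  iff  V(G) can be partitioned into a 1-,2-,…,k-packing
PackingChromaticAtMost : Graph → ℕ → Set
PackingChromaticAtMost G k = Σ (V G → Fin k) (IsPackingColouring G k)

cycle : ℕ → Graph
cycle zero    = record { V = Fin zero ; E = Fin zero ; ends = λ () }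
cycle (suc k) = record { V = Fin (suc k) ; E = Fin (suc k)
                       ; ends = λ i → (i , (suc (toℕ i)) mod (suc k)) }

path : ℕ → Graph
path zero    = record { V = Fin zero ; E = Fin zero ; ends = λ () }
path (suc q) = record { V = Fin (suc q) ; E = Fin q
                      ; ends = λ i → (inject₁ i , fsuc i) }

-- neighbourhood corona G ⋆ H : vertices V G ⊎ (V G × V H), where (w , h) is
-- vertex h of the copy H_w; edges: those of G, those of each copy H_w,
-- and for each edge {a , b} of G and h ∈ V H the edges {a , (b , h)} and
-- {b , (a , h)} (every vertex of H_w joined to every neighbour of w).
corona : Graph → Graph → Graph
corona G H = record
  { V    = V G ⊎ (V G × V H)
  ; E    = E G ⊎ ((V G × E H) ⊎ (E G × V H × Bool))
  ; ends = es
  }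
  where
  es : E G ⊎ ((V G × E H) ⊎ (E G × V H × Bool)) → (V G ⊎ (V G × V H)) × (V G ⊎ (V G × V H))
  es (inj₁ e) with ends G e
  ... | (a , b) = (inj₁ a , inj₁ b)
  es (inj₂ (inj₁ (w , f))) with ends H f
  ... | (h , h') = (inj₂ (w , h) , inj₂ (w , h'))
  es (inj₂ (inj₂ (e , h , true))) with ends G e
  ... | (a , b) = (inj₁ a , inj₂ (b , h))
  es (inj₂ (inj₂ (e , h , false))) with ends G e
  ... | (a , b) = (inj₁ b , inj₂ (a , h))

-- finite super subdivision FSSD_m(G): each edge xy replaced by K_{2,m},
-- i.e. m new vertices (e , j) each adjacent exactly to the ends x , y of e.
FSSD : ℕ → Graph → Graph
FSSD m G = record
  { V    = V G ⊎ (E G × Fin m)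
  ; E    = E G × Fin m × Bool
  ; ends = es
  }
  where
  es : E G × Fin m × Bool → (V G ⊎ (E G × Fin m)) × (V G ⊎ (E G × Fin m))
  es (e , j , true) with ends G e
  ... | (x , y) = (inj₁ x , inj₂ (e , j))
  es (e , j , false) with ends G e
  ... | (x , y) = (inj₁ y , inj₂ (e , j))

bound : ℕ → ℕ
bound 3  = 6
bound 5  = 8
bound 7  = 8
bound 11 = 8
bound _  = 7

module Submission where

-- The colouring is the one of the paper: subdivision vertices get colour 1
-- (they form an independent set), the vertices of the path copies get colour
-- 2 or 3 according to a proper 2-colouring of P_p, and the cycle vertex a gets
-- a colour col(a) ≥ 4 such that two cycle vertices of equal colour c are at
-- cycle distance > ⌊c/2⌋.  This works because subdividing doubles distances:
-- a walk of length j between original vertices of FSSD_m(G) yields a walk of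
-- length ⌊j/2⌋ in G, and projecting G ⋆ H onto G does not increase distances.
--
-- It then builds such colourings of C_n: a
-- distinct colour per vertex for n = 3, and for larger n a cyclic word of
-- colours checked by a decidable "well-spaced" condition; every n ≥ 4 outside
-- {5,7,11} is a sum of the block lengths 4, 6, 9 (colours ≤ 7), while
-- n ∈ {5,7,11} use an explicit word with one colour 8.

open import Defs
open import Data.Nat using (ℕ; zero; suc; _+_; _∸_; _≤_; _<_; _≤?_; _≟_; z≤n; s≤s; pred; ⌊_/2⌋; parity; >-nonZero)
open import Data.Nat.Properties
open import Data.Nat.DivMod using (_%_; _mod_; m%n%n≡m%n; %-distribˡ-+; [m+n]%n≡m%n; m<n⇒m%n≡m; m≤n⇒[n∸m]%m≡n%m)
open import Data.Nat.GeneralisedArithmetic using (fold; iterate-is-fold)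
open import Data.Fin using (Fin; toℕ; fromℕ<)
open import Data.Fin.Properties using (toℕ-injective; toℕ<n; toℕ-fromℕ<; toℕ-inject₁)
open import Data.Parity.Base using (Parity; 0ℙ; 1ℙ)
open import Data.Parity.Properties using (p≢p⁻¹; suc-homo-⁻¹)
open import Data.Product using (Σ; ∃-syntax; _×_; _,_; proj₁; proj₂)
open import Data.Sum using (_⊎_; inj₁; inj₂)
open import Data.Bool using (true; false)
open import Data.Unit using (⊤; tt)
open import Data.Empty using (⊥; ⊥-elim)
open import Data.List using (List; []; _∷_; _++_; length; concatMap)
open import Data.List.Properties using (++-assoc)
open import Relation.Nullary using (¬_; Dec; yes; no)
open import Relation.Nullary.Decidable using (_×-dec_; ¬?; True; toWitness)
open import Relation.Binary.PropositionalEquality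

Incident : (G : Graph) → E G → V G → Set
Incident G e u = (u ≡ proj₁ (ends G e)) ⊎ (u ≡ proj₂ (ends G e))

module _ {G : Graph} where

  Within-refl : ∀ d x → Within G d x x
  Within-refl zero    x = refl
  Within-refl (suc d) x = inj₁ refl

  Within-mono : ∀ {i j x y} → i ≤ j → Within G i x y → Within G j x y
  Within-mono {zero}  {j}     _         refl                = Within-refl j _
  Within-mono {suc i} {suc j} _         (inj₁ x≡y)          = inj₁ x≡y
  Within-mono {suc i} {suc j} (s≤s i≤j) (inj₂ (z , xz , w)) = inj₂ (z , xz , Within-mono i≤j w)

  Within-trans : ∀ i {j x z y} → Within G i x z → Within G j z y → Within G (i + j) x y
  Within-trans zero    refl                 w = w
  Within-trans (suc i) {j} (inj₁ refl)      w = Within-mono (m≤n+m j (suc i)) w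
  Within-trans (suc i) (inj₂ (z' , xz' , w')) w = inj₂ (z' , xz' , Within-trans i w' w)

  adjacent⇒within : ∀ {x y} → Adj G x y → Within G 1 x y
  adjacent⇒within {y = y} xy = inj₂ (y , xy , refl)

  incident⇒within : ∀ {e u u'} → Incident G e u → Incident G e u' → Within G 1 u u'
  incident⇒within (inj₁ refl) (inj₁ refl) = Within-refl 1 _
  incident⇒within (inj₂ refl) (inj₂ refl) = Within-refl 1 _
  incident⇒within {e} (inj₁ refl) (inj₂ refl) = adjacent⇒within (e , inj₁ refl)
  incident⇒within {e} (inj₂ refl) (inj₁ refl) = adjacent⇒within (e , inj₂ refl)

-- The finite super subdivision FSSD_m(G) halves distances

module _ {m : ℕ} {G : Graph} where

  original-neighbour : ∀ {a z} → Adj (FSSD m G) (inj₁ a) z →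
                       ∃[ e ] ∃[ t ] (z ≡ inj₂ (e , t)) × Incident G e a
  original-neighbour ((e , t , true)  , inj₁ refl) = e , t , refl , inj₁ refl
  original-neighbour ((e , t , false) , inj₁ refl) = e , t , refl , inj₂ refl

  subdivision-neighbour : ∀ {e t z} → Adj (FSSD m G) (inj₂ (e , t)) z → ∃[ u ] (z ≡ inj₁ u) × Incident G e u
  subdivision-neighbour ((e , t , true)  , inj₂ refl) = _ , refl , inj₁ refl
  subdivision-neighbour ((e , t , false) , inj₂ refl) = _ , refl , inj₂ refl

  subdivisions-apart : ∀ {s s'} → inj₂ s ≢ inj₂ s' → ¬ Within (FSSD m G) 1 (inj₂ s) (inj₂ s')
  subdivisions-apart s≢s' (inj₁ eq) = s≢s' eq
  subdivisions-apart s≢s' (inj₂ (z , sz , zs')) with subdivision-neighbour sz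
  subdivisions-apart s≢s' (inj₂ (_ , _ , ())) | _ , refl , _

  -- dist_F(a , b) ≤ j implies dist_G(a , b) ≤ ⌊j/2⌋ for original vertices a, b;
  -- from a subdivision vertex of an edge at u one more step of G is used
  halve : ∀ j {a b} → Within (FSSD m G) j (inj₁ a) (inj₁ b) → Within G ⌊ j /2⌋ a b
  halve-from : ∀ j {e t u b} → Incident G e u → Within (FSSD m G) j (inj₂ (e , t)) (inj₁ b) →
               Within G ⌊ suc j /2⌋ u b

  halve zero    refl        = refl
  halve (suc j) (inj₁ refl) = Within-refl _ _
  halve (suc j) (inj₂ (z , az , w)) with original-neighbour az
  ... | e , t , refl , ea = halve-from j ea w

  halve-from zero    eu ()
  halve-from (suc j) eu (inj₁ ())
  halve-from (suc j) eu (inj₂ (z , sz , w)) with subdivision-neighbour sz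
  ... | u' , refl , eu' = Within-trans 1 (incident⇒within eu eu') (halve j w)

-- The neighbourhood corona G ⋆ H projects onto G

module _ {G H : Graph} where

  base : V (corona G H) → V G
  base (inj₁ a)       = a
  base (inj₂ (a , _)) = a

  base-adjacent : ∀ {u v} → Adj (corona G H) u v → Within G 1 (base u) (base v)
  base-adjacent (inj₁ e , inj₁ refl)                      = adjacent⇒within (e , inj₁ refl)
  base-adjacent (inj₁ e , inj₂ refl)                      = adjacent⇒within (e , inj₂ refl)
  base-adjacent (inj₂ (inj₁ _) , inj₁ refl)               = Within-refl 1 _
  base-adjacent (inj₂ (inj₁ _) , inj₂ refl)               = Within-refl 1 _
  base-adjacent (inj₂ (inj₂ (e , _ , true))  , inj₁ refl) = adjacent⇒within (e , inj₁ refl)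
  base-adjacent (inj₂ (inj₂ (e , _ , true))  , inj₂ refl) = adjacent⇒within (e , inj₂ refl)
  base-adjacent (inj₂ (inj₂ (e , _ , false)) , inj₁ refl) = adjacent⇒within (e , inj₂ refl)
  base-adjacent (inj₂ (inj₂ (e , _ , false)) , inj₂ refl) = adjacent⇒within (e , inj₁ refl)

  base-within : ∀ d {u v} → Within (corona G H) d u v → Within G d (base u) (base v)
  base-within zero    refl                = refl
  base-within (suc d) (inj₁ refl)         = Within-refl _ _
  base-within (suc d) (inj₂ (z , uz , w)) = Within-trans 1 (base-adjacent uz) (base-within d w)

  copies-adjacent : ∀ {x y} → Adj (corona G H) (inj₂ x) (inj₂ y) → Adj H (proj₂ x) (proj₂ y)
  copies-adjacent (inj₂ (inj₁ (_ , f)) , inj₁ refl) = f , inj₁ refl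
  copies-adjacent (inj₂ (inj₁ (_ , f)) , inj₂ refl) = f , inj₂ refl
  copies-adjacent (inj₁ _ , inj₁ ())
  copies-adjacent (inj₁ _ , inj₂ ())
  copies-adjacent (inj₂ (inj₂ (_ , _ , true))  , inj₁ ())
  copies-adjacent (inj₂ (inj₂ (_ , _ , true))  , inj₂ ())
  copies-adjacent (inj₂ (inj₂ (_ , _ , false)) , inj₁ ())
  copies-adjacent (inj₂ (inj₂ (_ , _ , false)) , inj₂ ())

numbering-bound : (G : Graph) (K : ℕ) (c : V G → ℕ) → (∀ x → 1 ≤ c x) → (∀ x → c x ≤ K) →
                  (∀ x y → x ≢ y → c x ≡ c y → ¬ Within G (c x) x y) →
                  PackingChromaticAtMost G K
numbering-bound G K c positive bounded packs = colour , is-packing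
  where
  suc-pred-c : ∀ x → suc (pred (c x)) ≡ c x
  suc-pred-c x = suc-pred (c x) {{>-nonZero (positive x)}}

  index<K : ∀ x → pred (c x) < K
  index<K x = subst (_≤ K) (sym (suc-pred-c x)) (bounded x)

  colour : V G → Fin K
  colour x = fromℕ< (index<K x)

  number : ∀ x → suc (toℕ (colour x)) ≡ c x
  number x = trans (cong suc (toℕ-fromℕ< (index<K x))) (suc-pred-c x)

  is-packing : IsPackingColouring G K colour
  is-packing x y x≢y same =
    subst (λ j → ¬ Within G j x y) (sym (number x))
          (packs x y x≢y (trans (sym (number x)) (trans (cong (λ i → suc (toℕ i)) same) (number y))))

Spaced : (G : Graph) → (V G → ℕ) → Set
Spaced G col = ∀ a b → a ≢ b → col a ≡ col b → ¬ Within G ⌊ col a /2⌋ a b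

record HalfPackingColouring (G : Graph) (K : ℕ) : Set where
  field
    colour  : V G → ℕ
    large   : ∀ a → 4 ≤ colour a
    bounded : ∀ a → colour a ≤ K
    spaced  : Spaced G colour

TwoColouring : Graph → Set
TwoColouring H = Σ (V H → Parity) λ κ → ∀ {h h'} → Adj H h h' → κ h ≢ κ h'

copyColour : Parity → ℕ
copyColour 0ℙ = 2
copyColour 1ℙ = 3

copyColour-injective : ∀ {π π'} → copyColour π ≡ copyColour π' → π ≡ π'
copyColour-injective {0ℙ} {0ℙ} _ = refl
copyColour-injective {1ℙ} {1ℙ} _ = refl

copyColour-range : ∀ π → 2 ≤ copyColour π × copyColour π ≤ 3
copyColour-range 0ℙ = s≤s (s≤s z≤n) , s≤s (s≤s z≤n)
copyColour-range 1ℙ = s≤s (s≤s z≤n) , ≤-refl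

small≢large : ∀ {i j} → i ≤ 3 → 4 ≤ j → i ≢ j
small≢large i≤3 4≤j = <⇒≢ (≤-<-trans i≤3 4≤j)

module CoronaColouring (m : ℕ) {G H : Graph} {K : ℕ} (3≤K : 3 ≤ K)
                       (κ : V H → Parity) (proper : ∀ {h h'} → Adj H h h' → κ h ≢ κ h')
                       (χ : HalfPackingColouring G K) where

  open HalfPackingColouring χ

  F : Graph
  F = FSSD m (corona G H)

  number : V F → ℕ
  number (inj₂ _)              = 1
  number (inj₁ (inj₂ (_ , h))) = copyColour (κ h)
  number (inj₁ (inj₁ a))       = colour a

  positive : ∀ x → 1 ≤ number x
  positive (inj₂ _)              = s≤s z≤n
  positive (inj₁ (inj₂ (_ , h))) = ≤-trans (s≤s z≤n) (proj₁ (copyColour-range (κ h)))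
  positive (inj₁ (inj₁ a))       = ≤-trans (s≤s z≤n) (large a)

  bounded-number : ∀ x → number x ≤ K
  bounded-number (inj₂ _)              = ≤-trans (s≤s z≤n) 3≤K
  bounded-number (inj₁ (inj₂ (_ , h))) = ≤-trans (proj₂ (copyColour-range (κ h))) 3≤K
  bounded-number (inj₁ (inj₁ a))       = bounded a

  -- copy vertices of equal κ-colour are at distance > 3 in F: otherwise they
  -- would be at distance ≤ 1 in G ⋆ H, hence adjacent in H
  copies-apart : (x y : V G × V H) → x ≢ y → κ (proj₂ x) ≡ κ (proj₂ y) →
                 ¬ Within F 3 (inj₁ (inj₂ x)) (inj₁ (inj₂ y))
  copies-apart x y x≢y same w with halve 3 w
  ... | inj₁ refl              = x≢y refl
  ... | inj₂ (_ , xy , refl)   = proper (copies-adjacent xy) same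

  -- vertices of G of equal colour c are at distance > c in F, since their
  -- distance in G is > ⌊c/2⌋
  originals-apart : ∀ a b → a ≢ b → colour a ≡ colour b →
                    ¬ Within F (colour a) (inj₁ (inj₁ a)) (inj₁ (inj₁ b))
  originals-apart a b a≢b same w = spaced a b a≢b same (base-within _ (halve (colour a) w))

  packs : ∀ x y → x ≢ y → number x ≡ number y → ¬ Within F (number x) x y
  packs (inj₂ _) (inj₂ _) x≢y _ = subdivisions-apart x≢y
  packs (inj₁ (inj₂ x)) (inj₁ (inj₂ y)) x≢y same w =
    copies-apart x y (λ x≡y → x≢y (cong (λ z → inj₁ (inj₂ z)) x≡y)) (copyColour-injective same)
                 (Within-mono (proj₂ (copyColour-range (κ (proj₂ x)))) w)
  packs (inj₁ (inj₁ a)) (inj₁ (inj₁ b)) x≢y same =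
    originals-apart a b (λ a≡b → x≢y (cong (λ z → inj₁ (inj₁ z)) a≡b)) same
  packs (inj₂ _) (inj₁ (inj₂ (_ , h))) _ same = ⊥-elim (<⇒≢ (proj₁ (copyColour-range (κ h))) same)
  packs (inj₁ (inj₂ (_ , h))) (inj₂ _) _ same = ⊥-elim (<⇒≢ (proj₁ (copyColour-range (κ h))) (sym same))
  packs (inj₂ _) (inj₁ (inj₁ b)) _ same = ⊥-elim (small≢large (s≤s z≤n) (large b) same)
  packs (inj₁ (inj₁ a)) (inj₂ _) _ same = ⊥-elim (small≢large (s≤s z≤n) (large a) (sym same))
  packs (inj₁ (inj₂ (_ , h))) (inj₁ (inj₁ b)) _ same =
    ⊥-elim (small≢large (proj₂ (copyColour-range (κ h))) (large b) same)
  packs (inj₁ (inj₁ a)) (inj₁ (inj₂ (_ , h))) _ same =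
    ⊥-elim (small≢large (proj₂ (copyColour-range (κ h))) (large a) (sym same))

  packing-colouring : PackingChromaticAtMost F K
  packing-colouring = numbering-bound F K number positive bounded-number packs

fssd-corona-bound : (m : ℕ) {G H : Graph} {K : ℕ} → 3 ≤ K → TwoColouring H →
                    HalfPackingColouring G K → PackingChromaticAtMost (FSSD m (corona G H)) K
fssd-corona-bound m 3≤K (κ , proper) χ = CoronaColouring.packing-colouring m 3≤K κ proper χ

path-two-colouring : (p : ℕ) → TwoColouring (path p)
path-two-colouring zero    = (λ ()) , λ { {()} }
path-two-colouring (suc q) = (λ h → parity (toℕ h)) , consecutive
  where
  consecutive : ∀ {h h'} → Adj (path (suc q)) h h' → parity (toℕ h) ≢ parity (toℕ h')
  consecutive (f , inj₁ refl) eq rewrite toℕ-inject₁ f =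
    p≢p⁻¹ (parity (suc (toℕ f))) (trans (sym eq) (sym (suc-homo-⁻¹ (toℕ f))))
  consecutive (f , inj₂ refl) eq rewrite toℕ-inject₁ f =
    p≢p⁻¹ (parity (suc (toℕ f))) (trans eq (sym (suc-homo-⁻¹ (toℕ f))))

-- Colour words

-- the entry at position i of a list (0 past its end)
nth : ℕ → List ℕ → ℕ
nth _       []       = 0
nth zero    (x ∷ _)  = x
nth (suc i) (_ ∷ xs) = nth i xs

nth-++ˡ : ∀ L M {i} → i < length L → nth i (L ++ M) ≡ nth i L
nth-++ˡ (x ∷ L) M {zero}  _         = refl
nth-++ˡ (x ∷ L) M {suc i} (s≤s i<n) = nth-++ˡ L M i<n

nth-++ʳ : ∀ L M q → nth (length L + q) (L ++ M) ≡ nth q M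
nth-++ʳ []      M q = refl
nth-++ʳ (x ∷ L) M q = nth-++ʳ L M q

Avoids : ℕ → ℕ → List ℕ → Set
Avoids zero    x ys       = ⊤
Avoids (suc g) x []       = ⊥
Avoids (suc g) x (y ∷ ys) = y ≢ x × Avoids g x ys

avoids? : ∀ g x ys → Dec (Avoids g x ys)
avoids? zero    x ys       = yes tt
avoids? (suc g) x []       = no (λ ())
avoids? (suc g) x (y ∷ ys) = ¬? (y ≟ x) ×-dec avoids? g x ys

avoids-nth : ∀ {g x ys k} → Avoids g x ys → k < g → nth k ys ≢ x
avoids-nth {suc g} {ys = y ∷ ys} {zero}  (y≢x , _) _         = y≢x
avoids-nth {suc g} {ys = y ∷ ys} {suc k} (_ , rest) (s≤s k<g) = avoids-nth rest k<g

WellSpaced : ℕ → List ℕ → List ℕ → Set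
WellSpaced K T []       = ⊤
WellSpaced K T (x ∷ xs) = (4 ≤ x × x ≤ K) × Avoids ⌊ x /2⌋ x (xs ++ T) × WellSpaced K T xs

wellSpaced? : ∀ K T L → Dec (WellSpaced K T L)
wellSpaced? K T []       = yes tt
wellSpaced? K T (x ∷ xs) =
  ((4 ≤? x) ×-dec (x ≤? K)) ×-dec avoids? ⌊ x /2⌋ x (xs ++ T) ×-dec wellSpaced? K T xs

wellSpaced-++ : ∀ {K T} X {Y} → WellSpaced K (Y ++ T) X → WellSpaced K T Y → WellSpaced K T (X ++ Y)
wellSpaced-++ []                    _                    wY = wY
wellSpaced-++ {T = T} (x ∷ X) {Y} (range , avoid , wX) wY =
  range , subst (Avoids ⌊ x /2⌋ x) (sym (++-assoc X Y T)) avoid , wellSpaced-++ X wX wY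

record SpacedAt (K : ℕ) (T L : List ℕ) (p : ℕ) : Set where
  field
    lower : 4 ≤ nth p L
    upper : nth p L ≤ K
    ahead : ∀ k → 1 ≤ k → k ≤ ⌊ nth p L /2⌋ → nth (p + k) (L ++ T) ≢ nth p L

wellSpaced-at : ∀ {K T} L → WellSpaced K T L → ∀ p → p < length L → SpacedAt K T L p
wellSpaced-at (x ∷ xs) ((4≤x , x≤K) , avoid , _) zero _ = record
  { lower = 4≤x ; upper = x≤K ; ahead = λ { (suc k) _ k<g → avoids-nth avoid k<g } }
wellSpaced-at (x ∷ xs) (_ , _ , rest) (suc p) (s≤s p<n) = record
  { lower = SpacedAt.lower at ; upper = SpacedAt.upper at ; ahead = SpacedAt.ahead at }
  where at = wellSpaced-at xs rest p p<n

-- Distances on the cycle C_N, N = suc n'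

module Cycle (n' : ℕ) where

  N : ℕ
  N = suc n'

  next : Fin N → Fin N
  next a = suc (toℕ a) mod N

  advance : ℕ → Fin N → Fin N
  advance k a = fold a next k

  advance-next : ∀ k a → advance k (next a) ≡ advance (suc k) a
  advance-next k a = trans (iterate-is-fold (next a) next k) (sym (iterate-is-fold a next (suc k)))

  suc-%-absorb : ∀ m' → suc (m' % N) % N ≡ suc m' % N
  suc-%-absorb m' = begin
    (1 + m' % N) % N          ≡⟨ %-distribˡ-+ 1 (m' % N) N ⟩
    (1 % N + m' % N % N) % N  ≡⟨ cong (λ r → (1 % N + r) % N) (m%n%n≡m%n m' N) ⟩
    (1 % N + m' % N) % N      ≡⟨ %-distribˡ-+ 1 m' N ⟨
    (1 + m') % N              ∎
    where open ≡-Reasoning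

  toℕ-advance : ∀ k a → toℕ (advance k a) ≡ (toℕ a + k) % N
  toℕ-advance zero a = begin
    toℕ a            ≡⟨ m<n⇒m%n≡m (toℕ<n a) ⟨
    toℕ a % N        ≡⟨ cong (_% N) (+-identityʳ (toℕ a)) ⟨
    (toℕ a + 0) % N  ∎
    where open ≡-Reasoning
  toℕ-advance (suc k) a = begin
    toℕ (next (advance k a))      ≡⟨ toℕ-fromℕ< _ ⟩
    suc (toℕ (advance k a)) % N   ≡⟨ cong (λ r → suc r % N) (toℕ-advance k a) ⟩
    suc ((toℕ a + k) % N) % N     ≡⟨ suc-%-absorb (toℕ a + k) ⟩
    suc (toℕ a + k) % N           ≡⟨ cong (_% N) (+-suc (toℕ a) k) ⟨
    (toℕ a + suc k) % N           ∎
    where open ≡-Reasoning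

  advance-N : ∀ a → advance N a ≡ a
  advance-N a = toℕ-injective (begin
    toℕ (advance N a)  ≡⟨ toℕ-advance N a ⟩
    (toℕ a + N) % N    ≡⟨ [m+n]%n≡m%n (toℕ a) N ⟩
    toℕ a % N          ≡⟨ m<n⇒m%n≡m (toℕ<n a) ⟩
    toℕ a              ∎)
    where open ≡-Reasoning

  -- next is a bijection, being undone by n' further steps
  next-injective : ∀ {a b} → next a ≡ next b → a ≡ b
  next-injective {a} {b} eq = begin
    a                    ≡⟨ advance-N a ⟨
    advance N a          ≡⟨ advance-next n' a ⟨
    advance n' (next a)  ≡⟨ cong (advance n') eq ⟩
    advance n' (next b)  ≡⟨ advance-next n' b ⟩
    advance N b          ≡⟨ advance-N b ⟩
    b                    ∎
    where open ≡-Reasoning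

  Near : ℕ → Fin N → Fin N → Set
  Near d a b = ∃[ k ] k ≤ d × ((b ≡ advance k a) ⊎ (a ≡ advance k b))

  cycle-adjacent : ∀ {a c} → Adj (cycle N) a c → (c ≡ next a) ⊎ (a ≡ next c)
  cycle-adjacent (_ , inj₁ refl) = inj₁ refl
  cycle-adjacent (_ , inj₂ refl) = inj₂ refl

  Near-step : ∀ {d a c b} → (c ≡ next a) ⊎ (a ≡ next c) → Near d c b → Near (suc d) a b
  Near-step {a = a} (inj₁ refl) (k , k≤d , inj₁ refl) = suc k , s≤s k≤d , inj₁ (advance-next k a)
  Near-step (inj₁ refl) (zero , _ , inj₂ refl) = 1 , s≤s z≤n , inj₁ refl
  Near-step (inj₁ refl) (suc k , k<d , inj₂ eq) =
    k , m≤n⇒m≤1+n (<⇒≤ k<d) , inj₂ (next-injective eq)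
  Near-step (inj₂ refl) (zero , _ , inj₁ refl) = 1 , s≤s z≤n , inj₂ refl
  Near-step {c = c} (inj₂ refl) (suc k , k<d , inj₁ refl) =
    k , m≤n⇒m≤1+n (<⇒≤ k<d) , inj₁ (sym (advance-next k c))
  Near-step (inj₂ refl) (k , k≤d , inj₂ refl) = suc k , s≤s k≤d , inj₂ refl

  within⇒near : ∀ d {a b} → Within (cycle N) d a b → Near d a b
  within⇒near zero    refl                = 0 , z≤n , inj₁ refl
  within⇒near (suc d) (inj₁ refl)         = 0 , z≤n , inj₁ refl
  within⇒near (suc d) (inj₂ (c , ac , w)) = Near-step (cycle-adjacent ac) (within⇒near d w)

  spaced-ahead : (col : Fin N → ℕ) →
                 (∀ a k → 1 ≤ k → k ≤ ⌊ col a /2⌋ → col (advance k a) ≢ col a) →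
                 Spaced (cycle N) col
  spaced-ahead col ahead a b a≢b same w with within⇒near _ w
  ... | zero  , _   , inj₁ refl = a≢b refl
  ... | zero  , _   , inj₂ refl = a≢b refl
  ... | suc k , k≤d , inj₁ refl = ahead a (suc k) (s≤s z≤n) k≤d (sym same)
  ... | suc k , k≤d , inj₂ refl =
    ahead b (suc k) (s≤s z≤n) (subst (λ c → suc k ≤ ⌊ c /2⌋) same k≤d) same

  distinct-colouring : HalfPackingColouring (cycle N) (3 + N)
  distinct-colouring = record
    { colour  = λ a → 4 + toℕ a
    ; large   = λ a → m≤m+n 4 (toℕ a)
    ; bounded = λ a → +-monoʳ-≤ 3 (toℕ<n a)
    ; spaced  = λ a b a≢b same _ → a≢b (toℕ-injective (+-cancelˡ-≡ 4 _ _ same))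
    }

  nth-cyclic : ∀ L → length L ≡ N → ∀ {i} → i < N + N → nth (i % N) L ≡ nth i (L ++ L)
  nth-cyclic L len {i} i<2N with i <? N
  ... | yes i<N = begin
    nth (i % N) L   ≡⟨ cong (λ j → nth j L) (m<n⇒m%n≡m i<N) ⟩
    nth i L         ≡⟨ nth-++ˡ L L (subst (i <_) (sym len) i<N) ⟨
    nth i (L ++ L)  ∎
    where open ≡-Reasoning
  ... | no i≮N = begin
    nth (i % N) L                      ≡⟨ cong (λ j → nth j L) (m≤n⇒[n∸m]%m≡n%m N≤i) ⟨
    nth ((i ∸ N) % N) L                ≡⟨ cong (λ j → nth j L) (m<n⇒m%n≡m i∸N<N) ⟩
    nth (i ∸ N) L                      ≡⟨ nth-++ʳ L L (i ∸ N) ⟨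
    nth (length L + (i ∸ N)) (L ++ L)  ≡⟨ cong (λ j → nth (j + (i ∸ N)) (L ++ L)) len ⟩
    nth (N + (i ∸ N)) (L ++ L)         ≡⟨ cong (λ j → nth j (L ++ L)) (m+[n∸m]≡n N≤i) ⟩
    nth i (L ++ L)                     ∎
    where
    open ≡-Reasoning
    N≤i : N ≤ i
    N≤i = ≮⇒≥ i≮N
    i∸N<N : i ∸ N < N
    i∸N<N = +-cancelˡ-< N (i ∸ N) N (subst (_< N + N) (sym (m+[n∸m]≡n N≤i)) i<2N)

  -- the colouring of C_N read off a word L of length N that is well spaced
  -- when followed by itself
  word-colouring : ∀ {K} L → length L ≡ N → ⌊ K /2⌋ ≤ N → WellSpaced K L L →
                   HalfPackingColouring (cycle N) K
  word-colouring {K} L len K/2≤N well = record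
    { colour  = col
    ; large   = λ a → SpacedAt.lower (at a)
    ; bounded = λ a → SpacedAt.upper (at a)
    ; spaced  = spaced-ahead col ahead
    }
    where
    col : Fin N → ℕ
    col a = nth (toℕ a) L

    at : ∀ a → SpacedAt K L L (toℕ a)
    at a = wellSpaced-at L well (toℕ a) (subst (toℕ a <_) (sym len) (toℕ<n a))

    ahead : ∀ a k → 1 ≤ k → k ≤ ⌊ col a /2⌋ → col (advance k a) ≢ col a
    ahead a k 1≤k k≤ = subst (_≢ col a) (sym read-ahead) (SpacedAt.ahead (at a) k 1≤k k≤)
      where
      open ≡-Reasoning
      k≤N : k ≤ N
      k≤N = ≤-trans k≤ (≤-trans (⌊n/2⌋-mono (SpacedAt.upper (at a))) K/2≤N)
      read-ahead : col (advance k a) ≡ nth (toℕ a + k) (L ++ L)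
      read-ahead = begin
        col (advance k a)          ≡⟨ cong (λ i → nth i L) (toℕ-advance k a) ⟩
        nth ((toℕ a + k) % N) L    ≡⟨ nth-cyclic L len (+-mono-<-≤ (toℕ<n a) k≤N) ⟩
        nth (toℕ a + k) (L ++ L)   ∎

-- Words with colours ≤ 7 for every length n ≥ 4 outside {5, 7, 11}

data Block : Set where
  four six nine : Block

blockTail : Block → List ℕ
blockTail four = 7 ∷ []
blockTail six  = 4 ∷ 5 ∷ 7 ∷ []
blockTail nine = 4 ∷ 7 ∷ 5 ∷ 4 ∷ 6 ∷ 7 ∷ []

block : Block → List ℕ
block b = 4 ∷ 5 ∷ 6 ∷ blockTail b

blocks : List Block → List ℕ
blocks = concatMap block

block-wellSpaced : ∀ b T → WellSpaced 7 (4 ∷ 5 ∷ 6 ∷ T) (block b)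
block-wellSpaced four T = toWitness {a? = wellSpaced? 7 (4 ∷ 5 ∷ 6 ∷ T) (block four)} tt
block-wellSpaced six  T = toWitness {a? = wellSpaced? 7 (4 ∷ 5 ∷ 6 ∷ T) (block six)} tt
block-wellSpaced nine T = toWitness {a? = wellSpaced? 7 (4 ∷ 5 ∷ 6 ∷ T) (block nine)} tt

blocks-then-456 : ∀ bs T → ∃[ T' ] blocks bs ++ 4 ∷ 5 ∷ 6 ∷ T ≡ 4 ∷ 5 ∷ 6 ∷ T'
blocks-then-456 []       T = T , refl
blocks-then-456 (b ∷ bs) T = _ , refl

blocks-wellSpaced : ∀ bs T → WellSpaced 7 (4 ∷ 5 ∷ 6 ∷ T) (blocks bs)
blocks-wellSpaced []       T = tt
blocks-wellSpaced (b ∷ bs) T with blocks-then-456 bs T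
... | T' , eq = wellSpaced-++ (block b)
                  (subst (λ W → WellSpaced 7 W (block b)) (sym eq) (block-wellSpaced b T'))
                  (blocks-wellSpaced bs T)

-- and, since it starts with 4, 5, 6, a sequence of blocks is cyclically well spaced
blocks-cyclic : ∀ bs → WellSpaced 7 (blocks bs) (blocks bs)
blocks-cyclic []       = tt
blocks-cyclic (b ∷ bs) = blocks-wellSpaced (b ∷ bs) (blockTail b ++ blocks bs)

longBlocks : ℕ → List Block
longBlocks 0 = four ∷ four ∷ four ∷ []
longBlocks 1 = four ∷ nine ∷ []
longBlocks 2 = six ∷ four ∷ four ∷ []
longBlocks 3 = six ∷ nine ∷ []
longBlocks (suc (suc (suc (suc k)))) = four ∷ longBlocks k

longBlocks-length : ∀ k → length (blocks (longBlocks k)) ≡ 12 + k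
longBlocks-length 0 = refl
longBlocks-length 1 = refl
longBlocks-length 2 = refl
longBlocks-length 3 = refl
longBlocks-length (suc (suc (suc (suc k)))) = cong (4 +_) (longBlocks-length k)

word-bound : ∀ {n'} K L → length L ≡ suc n' → ⌊ K /2⌋ ≤ suc n' → 3 ≤ K → WellSpaced K L L →
             ∀ m p → PackingChromaticAtMost (FSSD m (corona (cycle (suc n')) (path p))) K
word-bound {n'} K L len K/2≤N 3≤K well m p =
  fssd-corona-bound m 3≤K (path-two-colouring p) (Cycle.word-colouring n' L len K/2≤N well)

blocks-bound : ∀ {n'} bs → length (blocks bs) ≡ suc n' → 3 ≤ suc n' →
               ∀ m p → PackingChromaticAtMost (FSSD m (corona (cycle (suc n')) (path p))) 7
blocks-bound bs len 3≤N = word-bound 7 (blocks bs) len 3≤N (m≤m+n 3 4) (blocks-cyclic bs)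

eight-bound : ∀ {n'} L → length L ≡ suc n' → 4 ≤ suc n' → {True (wellSpaced? 8 L L)} →
              ∀ m p → PackingChromaticAtMost (FSSD m (corona (cycle (suc n')) (path p))) 8
eight-bound L len 4≤N {well} = word-bound 8 L len 4≤N (m≤m+n 3 5) (toWitness well)

theorem2 : (n m p : ℕ) → 3 ≤ n → 1 ≤ m → 2 ≤ p →
           PackingChromaticAtMost (FSSD m (corona (cycle n) (path p))) (bound n)
theorem2 1  _ _ (s≤s ()) _ _
theorem2 2  _ _ (s≤s (s≤s ())) _ _
theorem2 3  m p _   _ _ = fssd-corona-bound m (m≤m+n 3 3) (path-two-colouring p) (Cycle.distinct-colouring 2)
theorem2 4  m p 3≤n _ _ = blocks-bound (four ∷ []) refl 3≤n m p
theorem2 5  m p _   _ _ = eight-bound (4 ∷ 5 ∷ 6 ∷ 7 ∷ 8 ∷ []) refl (m≤m+n 4 1) m p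
theorem2 6  m p 3≤n _ _ = blocks-bound (six ∷ []) refl 3≤n m p
theorem2 7  m p _   _ _ = eight-bound (4 ∷ 5 ∷ 6 ∷ 4 ∷ 5 ∷ 7 ∷ 8 ∷ []) refl (m≤m+n 4 3) m p
theorem2 8  m p 3≤n _ _ = blocks-bound (four ∷ four ∷ []) refl 3≤n m p
theorem2 9  m p 3≤n _ _ = blocks-bound (nine ∷ []) refl 3≤n m p
theorem2 10 m p 3≤n _ _ = blocks-bound (six ∷ four ∷ []) refl 3≤n m p
theorem2 11 m p _   _ _ =
  eight-bound (4 ∷ 5 ∷ 6 ∷ 4 ∷ 5 ∷ 7 ∷ 4 ∷ 5 ∷ 6 ∷ 7 ∷ 8 ∷ []) refl (m≤m+n 4 7) m p
theorem2 (suc (suc (suc (suc (suc (suc (suc (suc (suc (suc (suc (suc k)))))))))))) m p 3≤n _ _ =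
  blocks-bound (longBlocks k) (longBlocks-length k) 3≤n m p
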